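{- For every integer $n\ge 1$ and every integer $k$ with $0\le k\le 2n$, we have $z_{2n,k}=a_{2n-k,\,k}$.
   Context: For nonnegative integers $p,q$, let $a_{p,q}$ be the number of ways to partition a set consisting of $p$ marked points on a line and $q$ marked points on a parallel line into pairs, joining the two points of each pair by a straight segment, such that no two segments have a common point (in particular, no endpoint lies on another segment). We have $a_{0,0}=1$. The fence $Z_{2n}$ is the directed graph with vertices $u_1,\dots,u_n$ (upper) and $v_1,\dots,v_n$ (lower). Its arcs are $u_i\to v_i$ for $1\le i\le n$ and $u_i\to v_{i+1}$ for $1\le i\le n-1$. A set $A$ of vertices is closed if for every arc $x\to y$ with $x\in A$ we also have $y\in A$. $z_{2n,k}$ denotes the number of closed sets of $Z_{2n}$ with exactly $k$ elements. -}

module Defs where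

import Agda.Primitive

open import Data.Nat using (ℕ; zero; suc; _+_)
import Data.Nat.Properties as ℕP
open import Data.Fin using (Fin; toℕ; _<_; splitAt; join)
open import Data.Fin.Properties using (all?; _<?_)
import Data.Fin.Properties as FinP
open import Data.Fin.Subset using (Subset; _∈_; ∣_∣)
open import Data.Fin.Subset.Properties using (_∈?_)
open import Data.Sum using (_⊎_; inj₁; inj₂)
import Data.Sum.Properties as SumP
open import Data.Product using (_×_; _,_; proj₁; proj₂)
open import Data.Bool using (Bool; true; false)
open import Data.Vec using (Vec; []; _∷_; lookup)
open import Data.List using (List; []; _∷_; [_]; map; concatMap; filter; length; allFin)
open import Relation.Nullary using (Dec; yes; no; ¬_; ¬?; _×-dec_; _→-dec_)
open import Relation.Nullary.Decidable using (map′)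
open import Relation.Unary using (Pred; Decidable)
open import Relation.Binary.PropositionalEquality using (_≡_; refl; _≢_)

count : ∀ {A : Set} {P : Pred A Agda.Primitive.lzero} → Decidable P → List A → ℕ
count P? xs = length (filter P? xs)

allVecs : ∀ {A : Set} → List A → (m : ℕ) → List (Vec A m)
allVecs xs zero    = [ [] ]
allVecs xs (suc m) = concatMap (λ x → map (x ∷_) (allVecs xs m)) xs

allSubsets : (n : ℕ) → List (Subset n)
allSubsets n = allVecs (Data.Bool.true ∷ Data.Bool.false ∷ []) n

-- The fence Z_{2n}.  Vertices u_1..u_n, v_1..v_n are written u i, v i
-- with i : Fin n (0-based, so u i stands for u_{i+1}).

data Vertex (n : ℕ) : Set where
  u : Fin n → Vertex n
  v : Fin n → Vertex n

data Arc {n : ℕ} : Vertex n → Vertex n → Set where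
  arc-straight : (i : Fin n) → Arc (u i) (v i)
  arc-diagonal : (i j : Fin n) → toℕ j ≡ suc (toℕ i) → Arc (u i) (v j)

VertexSet : ℕ → Set
VertexSet n = Subset n × Subset n

_∈V_ : ∀ {n} → Vertex n → VertexSet n → Set
u i ∈V A = i ∈ proj₁ A
v i ∈V A = i ∈ proj₂ A

sizeV : ∀ {n} → VertexSet n → ℕ
sizeV (U , L) = ∣ U ∣ + ∣ L ∣

Closed : ∀ {n} → VertexSet n → Set
Closed {n} A = ∀ (x y : Vertex n) → Arc x y → x ∈V A → y ∈V A

private
  Closed′ : ∀ {n} → VertexSet n → Set
  Closed′ (U , L) = (∀ i → i ∈ U → i ∈ L)
                  × (∀ i j → toℕ j ≡ suc (toℕ i) → i ∈ U → j ∈ L)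

  to : ∀ {n} (A : VertexSet n) → Closed A → Closed′ A
  to A c = (λ i → c _ _ (arc-straight i)) , (λ i j e → c _ _ (arc-diagonal i j e))

  from : ∀ {n} (A : VertexSet n) → Closed′ A → Closed A
  from A (c₁ , c₂) .(u i) .(v i) (arc-straight i) = c₁ i
  from A (c₁ , c₂) .(u i) .(v j) (arc-diagonal i j e) = c₂ i j e

closed? : ∀ {n} → Decidable (Closed {n})
closed? (U , L) = map′ (from (U , L)) (to (U , L))
  ( all? (λ i → (i ∈? U) →-dec (i ∈? L))
  ×-dec all? (λ i → all? (λ j → (toℕ j ℕP.≟ suc (toℕ i)) →-dec ((i ∈? U) →-dec (j ∈? L)))))

allVertexSets : (n : ℕ) → List (VertexSet n)
allVertexSets n = concatMap (λ U → map (U ,_) (allSubsets n)) (allSubsets n)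

ClosedOfSize : ∀ n → ℕ → VertexSet n → Set
ClosedOfSize n k A = Closed A × sizeV A ≡ k

-- z_{2n,k}: number of closed sets of Z_{2n} with exactly k elements
z : (n k : ℕ) → ℕ
z n k = count (λ A → closed? A ×-dec (sizeV A ℕP.≟ k)) (allVertexSets n)

-- Non-crossing matchings of p points on one line and q points on a
-- parallel line.  Points: top a (a : Fin p), bottom b (b : Fin q),
-- indexed from left to right along each line.

Point : ℕ → ℕ → Set
Point p q = Fin p ⊎ Fin q

-- A candidate pairing is encoded as a partner function, stored as a
-- vector indexed by Fin (p + q) (the points, via join/splitAt).
Pairing : ℕ → ℕ → Set
Pairing p q = Vec (Fin (p + q)) (p + q)

partner : ∀ {p q} → Pairing p q → Point p q → Point p q
partner {p} {q} μ x = splitAt p (lookup μ (join p q x))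

IsPartitionIntoPairs : ∀ {p q} → Pairing p q → Set
IsPartitionIntoPairs {p} {q} μ =
  ∀ (x : Point p q) → (partner {p} {q} μ x ≢ x) × (partner {p} {q} μ (partner {p} {q} μ x) ≡ x)

-- the segments joining the pairs pairwise have no common point:
--  * a segment joining two points of the same line contains no other
--    marked point of that line (no endpoint lies on it, which also makes
--    such segments pairwise disjoint), and
--  * two segments joining the two lines do not cross.
NoCommonPoints : ∀ {p q} → Pairing p q → Set
NoCommonPoints {p} {q} μ =
    (∀ (a b c : Fin p) → partner {p} {q} μ (inj₁ a) ≡ inj₁ b → a < c → c < b → ⊥′)
  × (∀ (a b c : Fin q) → partner {p} {q} μ (inj₂ a) ≡ inj₂ b → a < c → c < b → ⊥′)
  × (∀ (a a′ : Fin p) (b b′ : Fin q) →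
       partner {p} {q} μ (inj₁ a) ≡ inj₂ b → partner {p} {q} μ (inj₁ a′) ≡ inj₂ b′ →
       a < a′ → b < b′)
  where open import Data.Empty renaming (⊥ to ⊥′)

ValidPairing : ∀ {p q} → Pairing p q → Set
ValidPairing {p} {q} μ = IsPartitionIntoPairs {p} {q} μ × NoCommonPoints {p} {q} μ

allPoints? : ∀ {p q} {P : Point p q → Set} → (∀ x → Dec (P x)) → Dec (∀ x → P x)
allPoints? {P = P} P? =
  map′ (λ { (h₁ , h₂) (inj₁ i) → h₁ i ; (h₁ , h₂) (inj₂ j) → h₂ j })
       (λ h → (λ i → h (inj₁ i)) , (λ j → h (inj₂ j)))
       (all? (λ i → P? (inj₁ i)) ×-dec all? (λ j → P? (inj₂ j)))

validPairing? : ∀ {p q} → Decidable (ValidPairing {p} {q})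
validPairing? {p} {q} μ = let π = partner {p} {q} μ in
  ( allPoints? (λ x → ¬? (SumP.≡-dec FinP._≟_ FinP._≟_ (π x) x)
               ×-dec SumP.≡-dec FinP._≟_ FinP._≟_ (π (π x)) x) )
  ×-dec
  ( all? (λ a → all? (λ b → all? (λ c →
       SumP.≡-dec FinP._≟_ FinP._≟_ (π (inj₁ a)) (inj₁ b)
       →-dec ((a <? c) →-dec ((c <? b) →-dec no (λ ()))))))
  ×-dec all? (λ a → all? (λ b → all? (λ c →
       SumP.≡-dec FinP._≟_ FinP._≟_ (π (inj₂ a)) (inj₂ b)
       →-dec ((a <? c) →-dec ((c <? b) →-dec no (λ ()))))))
  ×-dec all? (λ a → all? (λ a′ → all? (λ b → all? (λ b′ →
       SumP.≡-dec FinP._≟_ FinP._≟_ (π (inj₁ a)) (inj₂ b)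
       →-dec (SumP.≡-dec FinP._≟_ FinP._≟_ (π (inj₁ a′)) (inj₂ b′)
       →-dec ((a <? a′) →-dec (b <? b′))))))) )

a : (p q : ℕ) → ℕ
a p q = count (validPairing? {p} {q}) (allVecs (allFin (p + q)) (p + q))

-- Read column by column, a closed set of Z_{2n} is a word in the columns ∅, {vᵢ} and {uᵢ, vᵢ}
-- in which {uᵢ, vᵢ} is never followed by ∅, because of the arc uᵢ → vᵢ₊₁. A non-crossing
-- pairing is read from the left: since a segment along a line may not pass over a marked
-- point, it pairs its two leftmost top points, or its two leftmost bottom points, or else its
-- leftmost top point with its leftmost bottom point. Splitting off top pairs before bottom
-- pairs, a pairing becomes a word in top, bottom and crossing pairs in which a bottom pair is
-- never followed by a top pair. Under ∅ ↦ top pair, {uᵢ, vᵢ} ↦ bottom pair, {vᵢ} ↦ crossing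
-- pair, a closed set with k elements corresponds to a pairing of 2n − k top and k bottom
-- points, and both families are enumerated by the same recurrences.

{-# OPTIONS --safe #-}
module Submission where

open import Defs
open import Data.Nat using (ℕ; zero; suc; _+_; _≤_; _*_; _∸_; z≤n; s≤s; s<s; s<s⁻¹)
open import Relation.Binary.PropositionalEquality using (_≡_)

open import Data.Bool using (Bool; true; false)
open import Data.Empty using (⊥; ⊥-elim)
open import Data.Unit using (⊤; tt)
open import Data.Fin using (Fin; zero; suc; _<_; _↑ʳ_; splitAt; join)
import Data.Fin.Properties as Fin
open import Data.Fin.Subset using (Subset; ∣_∣)
open import Data.Fin.Subset.Properties using (drop-there; ∣p∣≤n)
open import Data.List using (List; []; _∷_; [_]; map; concatMap; cartesianProductWith; length; allFin; _++_)
import Data.List.Properties as List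
open import Data.List.Membership.Propositional using (_∈_; _∉_)
open import Data.List.Membership.Propositional.Properties
  using (∈-filter⁺; ∈-filter⁻; ∈-map⁺; ∈-map⁻; ∈-++⁺ˡ; ∈-++⁺ʳ; ∈-++⁻)
open import Data.List.Membership.Propositional.Properties using (∈-cartesianProductWith⁺; ∈-allFin)
open import Data.List.Membership.Propositional.Properties.WithK using (unique∧set⇒bag)
open import Data.List.Relation.Binary.BagAndSetEquality using (∼bag⇒↭)
open import Data.List.Relation.Binary.Permutation.Propositional.Properties using (↭-length)
open import Data.List.Relation.Unary.All using ([]; _∷_)
open import Data.List.Relation.Unary.Any using (here; there)
open import Data.List.Relation.Unary.Unique.Propositional using (Unique; []; _∷_)
import Data.List.Relation.Unary.Unique.Propositional.Properties as Unique
import Data.Nat as ℕ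
import Data.Nat.Properties as ℕ
open import Data.Product using (_×_; _,_; proj₁; proj₂; ∃; map₂)
open import Data.Sum using (inj₁; inj₂)
import Data.Sum as Sum
import Data.Sum.Properties as Sum
open import Data.Vec using ([]; _∷_; here; there; lookup; tabulate)
import Data.Vec.Properties as Vec
open import Function using (_∘_; _⇔_; mk⇔; Equivalence)
open import Level using (0ℓ)
open import Relation.Binary.PropositionalEquality
  using (refl; sym; trans; cong; cong₂; subst; _≢_; _≗_; module ≡-Reasoning)
open import Relation.Nullary using (¬_; Dec; no)
open import Relation.Nullary.Decidable using (toSum)
open import Relation.Unary using (Pred; Decidable)

module _ {A : Set} where

  Enumerates : List A → Set
  Enumerates xs = Unique xs × (∀ x → x ∈ xs)

  count≡length : ∀ {P : Pred A 0ℓ} (P? : Decidable P) {xs ys : List A} →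
                 Enumerates xs → Unique ys → (∀ {y} → y ∈ ys ⇔ P y) →
                 count P? xs ≡ length ys
  count≡length P? {xs} (xs-unique , xs-complete) ys-unique ys⇔P =
    ↭-length (∼bag⇒↭ (unique∧set⇒bag (Unique.filter⁺ P? {xs} xs-unique) ys-unique (mk⇔
      (λ y∈ → Equivalence.from ys⇔P (proj₂ (∈-filter⁻ P? {xs = xs} y∈)))
      (λ y∈ → ∈-filter⁺ P? (xs-complete _) (Equivalence.to ys⇔P y∈)))))

  ++⁺-separated : (P : A → Set) {xs ys : List A} → Unique xs → Unique ys →
                  (∀ {x} → x ∈ xs → P x) → (∀ {y} → y ∈ ys → ¬ P y) → Unique (xs ++ ys)
  ++⁺-separated P xs-unique ys-unique xs⊆P ys⊆¬P =
    Unique.++⁺ xs-unique ys-unique (λ (x∈xs , x∈ys) → ys⊆¬P x∈ys (xs⊆P x∈xs))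

  empty⇒length≡0 : ∀ {xs : List A} → (∀ {x} → x ∉ xs) → length xs ≡ 0
  empty⇒length≡0 {[]} _ = refl
  empty⇒length≡0 {x ∷ xs} empty = ⊥-elim (empty (here refl))

∈-map-elim : ∀ {A B : Set} {P : B → Set} (f : A → B) {xs : List A} →
             (∀ {x} → x ∈ xs → P (f x)) → ∀ {y} → y ∈ map f xs → P y
∈-map-elim f P-image y∈ with _ , x∈ , refl ← ∈-map⁻ f y∈ = P-image x∈

length-map-++ : ∀ {A B : Set} (f : A → B) (xs : List A) (ys : List B) →
                length (map f xs ++ ys) ≡ length xs + length ys
length-map-++ f xs ys = trans (List.length-++ (map f xs)) (cong (_+ length ys) (List.length-map f xs))

concatMap-map≡cartesianProductWith : ∀ {A B C : Set} (f : A → B → C) (xs : List A) (ys : List B) →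
  concatMap (λ x → map (f x) ys) xs ≡ cartesianProductWith f xs ys
concatMap-map≡cartesianProductWith f [] ys = refl
concatMap-map≡cartesianProductWith f (x ∷ xs) ys =
  cong (map (f x) ys ++_) (concatMap-map≡cartesianProductWith f xs ys)

cartesianProductWith-enumerates : ∀ {A B C : Set} (f : A → B → C) →
  (∀ {a a′ b b′} → f a b ≡ f a′ b′ → a ≡ a′ × b ≡ b′) →
  (∀ c → ∃ λ a → ∃ λ b → c ≡ f a b) →
  ∀ {xs ys} → Enumerates xs → Enumerates ys → Enumerates (cartesianProductWith f xs ys)
cartesianProductWith-enumerates f f-injective f-surjective (xs-unique , xs-complete) (ys-unique , ys-complete) =
  Unique.cartesianProductWith⁺ f f-injective xs-unique ys-unique ,
  λ c → let (a , b , c≡fab) = f-surjective c in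
        subst (_∈ _) (sym c≡fab) (∈-cartesianProductWith⁺ f (xs-complete a) (ys-complete b))

allVecs-enumerates : ∀ {A : Set} {xs : List A} → Enumerates xs → ∀ m → Enumerates (allVecs xs m)
allVecs-enumerates xs-enum zero = ([] ∷ []) , λ { [] → here refl }
allVecs-enumerates {xs = xs} xs-enum (suc m) =
  subst Enumerates (sym (concatMap-map≡cartesianProductWith _∷_ xs (allVecs xs m)))
    (cartesianProductWith-enumerates _∷_ (λ { refl → refl , refl }) (λ { (x ∷ w) → x , w , refl })
       xs-enum (allVecs-enumerates xs-enum m))

allVertexSets-enumerates : ∀ n → Enumerates (allVertexSets n)
allVertexSets-enumerates n =
  subst Enumerates (sym (concatMap-map≡cartesianProductWith _,_ (allSubsets n) (allSubsets n)))
    (cartesianProductWith-enumerates _,_ (λ { refl → refl , refl }) (λ (U , L) → U , L , refl)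
       allSubsets-enumerates allSubsets-enumerates)
  where
  allSubsets-enumerates : Enumerates (allSubsets n)
  allSubsets-enumerates = allVecs-enumerates
    ((((λ ()) ∷ []) ∷ [] ∷ []) , λ { true → here refl ; false → there (here refl) }) n

allPairings-enumerates : ∀ p q → Enumerates (allVecs (allFin (p + q)) (p + q))
allPairings-enumerates p q = allVecs-enumerates (Unique.allFin⁺ (p + q) , ∈-allFin) (p + q)

-- Closed sets of the fence, column by column

-- Vacuous for the empty fence, so that a full column may come last.
Head∈ : ∀ {n} → Subset n → Set
Head∈ [] = ⊤
Head∈ (c ∷ _) = c ≡ true

data Column {n : ℕ} : Bool → Bool → Subset n → Set where
  empty : ∀ {L} → Column false false L
  lower : ∀ {L} → Column false true L
  full  : ∀ {L} → Head∈ L → Column true true L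

closed-[] : Closed {0} ([] , [])
closed-[] (u ()) _ _ _

closed-tail : ∀ {n b c} {U L : Subset n} → Closed (b ∷ U , c ∷ L) → Closed (U , L)
closed-tail closed _ _ (arc-straight i) i∈U =
  drop-there (closed _ _ (arc-straight (suc i)) (there i∈U))
closed-tail closed _ _ (arc-diagonal i j j≡1+i) i∈U =
  drop-there (closed _ _ (arc-diagonal (suc i) (suc j) (cong suc j≡1+i)) (there i∈U))

closed-column : ∀ {n b c} {U L : Subset n} → Closed (b ∷ U , c ∷ L) → Column b c L
closed-column {b = false} {false} _ = empty
closed-column {b = false} {true} _ = lower
closed-column {b = true} {false} closed with closed _ _ (arc-straight zero) here
... | ()
closed-column {b = true} {true} {L = []} _ = full tt
closed-column {b = true} {true} {L = _ ∷ _} closed =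
  full (Vec.[]=⇒lookup (drop-there (closed _ _ (arc-diagonal zero (suc zero) refl) here)))

closed-∷ : ∀ {n b c} {U L : Subset n} → Column b c L → Closed (U , L) → Closed (b ∷ U , c ∷ L)
closed-∷ (full _) closed _ _ (arc-straight zero) here = here
closed-∷ _ closed _ _ (arc-straight (suc i)) (there i∈U) = there (closed _ _ (arc-straight i) i∈U)
closed-∷ {L = _ ∷ _} (full refl) closed _ _ (arc-diagonal zero (suc zero) refl) here = there here
closed-∷ _ closed _ _ (arc-diagonal (suc i) (suc j) j≡1+i) (there i∈U) =
  there (closed _ _ (arc-diagonal i j (ℕ.suc-injective j≡1+i)) i∈U)
closed-∷ _ _ _ _ (arc-diagonal zero (suc (suc _)) ()) _
closed-∷ _ _ _ _ (arc-diagonal (suc _) zero ()) _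

Anchored : ∀ {n} → Bool → VertexSet n → Set
Anchored false _ = ⊤
Anchored true (_ , L) = Head∈ L

prepend : ∀ {n} → Bool → Bool → VertexSet n → VertexSet (suc n)
prepend b c (U , L) = b ∷ U , c ∷ L

prepend-injective : ∀ {n} b c {A B : VertexSet n} → prepend b c A ≡ prepend b c B → A ≡ B
prepend-injective b c refl = refl

firstColumn : ∀ {n} → VertexSet (suc n) → Bool × Bool
firstColumn (b ∷ _ , c ∷ _) = b , c

firstColumn-prepend : ∀ {n} b c {A} {As : List (VertexSet n)} →
                      A ∈ map (prepend b c) As → firstColumn A ≡ (b , c)
firstColumn-prepend b c A∈ with _ , _ , refl ← ∈-map⁻ (prepend b c) A∈ = refl

firstColumn-prepend-≢ : ∀ {n} b c {A} {As : List (VertexSet n)} {column} → (b , c) ≢ column →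
                        A ∈ map (prepend b c) As → firstColumn A ≢ column
firstColumn-prepend-≢ b c ≢column A∈ = ≢column ∘ trans (sym (firstColumn-prepend b c A∈))

sizeV-prepend-lower : ∀ {n} (A : VertexSet n) → sizeV (prepend false true A) ≡ suc (sizeV A)
sizeV-prepend-lower (U , L) = ℕ.+-suc ∣ U ∣ ∣ L ∣

sizeV-prepend-full : ∀ {n} (A : VertexSet n) → sizeV (prepend true true A) ≡ suc (suc (sizeV A))
sizeV-prepend-full A = cong suc (sizeV-prepend-lower A)

Anchored-prepend-lower : ∀ {n} t b (A : VertexSet n) → Anchored t (prepend b true A)
Anchored-prepend-lower false _ _ = tt
Anchored-prepend-lower true _ _ = refl

-- The flag requires v₁ ∈ A; it is raised after a full column because of the arc uᵢ → vᵢ₊₁.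
closedSets afterEmpty : (n k : ℕ) → Bool → List (VertexSet n)
afterFull afterLower : (n k : ℕ) → List (VertexSet n)

closedSets zero zero _ = [ [] , [] ]
closedSets zero (suc _) _ = []
closedSets (suc n) k t =
  map (prepend false false) (afterEmpty n k t) ++
  map (prepend true true) (afterFull n k) ++
  map (prepend false true) (afterLower n k)

afterEmpty n k false = closedSets n k false
afterEmpty n k true = []

afterFull n (suc (suc k)) = closedSets n k true
afterFull n _ = []

afterLower n (suc k) = closedSets n k false
afterLower n zero = []

closedSets-sound : ∀ n k t {A} → A ∈ closedSets n k t → ClosedOfSize n k A × Anchored t A
closedSets-sound zero zero false (here refl) = (closed-[] , refl) , tt
closedSets-sound zero zero true (here refl) = (closed-[] , refl) , tt
closedSets-sound (suc n) k t =
  Sum.[ ∈-map-elim {P = Sound k t} (prepend false false) (emptyFirst t) ,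
        Sum.[ ∈-map-elim {P = Sound k t} (prepend true true) (fullFirst k) ,
              ∈-map-elim {P = Sound k t} (prepend false true) (lowerFirst k) ]′
        ∘ ∈-++⁻ (map (prepend true true) (afterFull n k)) ]′
  ∘ ∈-++⁻ (map (prepend false false) (afterEmpty n k t))
  where
  Sound : ℕ → Bool → VertexSet (suc n) → Set
  Sound k t A = ClosedOfSize (suc n) k A × Anchored t A
  emptyFirst : ∀ t {B} → B ∈ afterEmpty n k t → Sound k t (prepend false false B)
  emptyFirst false B∈ with (closed , refl) , _ ← closedSets-sound n k false B∈ =
    (closed-∷ empty closed , refl) , tt
  fullFirst : ∀ k {B} → B ∈ afterFull n k → Sound k t (prepend true true B)
  fullFirst (suc (suc k)) {B} B∈ with (closed , refl) , head∈ ← closedSets-sound n k true B∈ =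
    (closed-∷ (full head∈) closed , sizeV-prepend-full B) , Anchored-prepend-lower t true B
  lowerFirst : ∀ k {B} → B ∈ afterLower n k → Sound k t (prepend false true B)
  lowerFirst (suc k) {B} B∈ with (closed , refl) , _ ← closedSets-sound n k false B∈ =
    (closed-∷ lower closed , sizeV-prepend-lower B) , Anchored-prepend-lower t false B

closedSets-complete : ∀ n t (A : VertexSet n) → Closed A → Anchored t A → A ∈ closedSets n (sizeV A) t
closedSets-complete zero t ([] , []) _ _ = here refl
closedSets-complete (suc n) t (b ∷ U , c ∷ L) closed = byColumn (closed-column closed) t
  where
  rest : ∀ t → Anchored t (U , L) → (U , L) ∈ closedSets n (sizeV (U , L)) t
  rest t = closedSets-complete n t (U , L) (closed-tail closed)
  byColumn : ∀ {b c} → Column b c L → ∀ t → Anchored t (b ∷ U , c ∷ L) →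
             (b ∷ U , c ∷ L) ∈ closedSets (suc n) (sizeV (b ∷ U , c ∷ L)) t
  byColumn empty false _ = ∈-++⁺ˡ (∈-map⁺ (prepend false false) (rest false tt))
  byColumn (full head∈) t _ =
    subst (λ k → prepend true true (U , L) ∈ closedSets (suc n) k t) (sym (sizeV-prepend-full (U , L)))
      (∈-++⁺ʳ (map (prepend false false) (afterEmpty n _ t))
        (∈-++⁺ˡ (∈-map⁺ (prepend true true) (rest true head∈))))
  byColumn lower t _ =
    subst (λ k → prepend false true (U , L) ∈ closedSets (suc n) k t) (sym (sizeV-prepend-lower (U , L)))
      (∈-++⁺ʳ (map (prepend false false) (afterEmpty n _ t))
        (∈-++⁺ʳ (map (prepend true true) (afterFull n (suc (sizeV (U , L)))))
          (∈-map⁺ (prepend false true) (rest false tt))))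

closedSets-unique : ∀ n k t → Unique (closedSets n k t)
afterEmpty-unique : ∀ n k t → Unique (afterEmpty n k t)
afterFull-unique : ∀ n k → Unique (afterFull n k)
afterLower-unique : ∀ n k → Unique (afterLower n k)

closedSets-unique zero zero _ = [] ∷ []
closedSets-unique zero (suc _) _ = []
closedSets-unique (suc n) k t =
  ++⁺-separated (λ A → firstColumn A ≡ (false , false))
    (Unique.map⁺ (prepend-injective false false) (afterEmpty-unique n k t))
    (++⁺-separated (λ A → firstColumn A ≡ (true , true))
      (Unique.map⁺ (prepend-injective true true) (afterFull-unique n k))
      (Unique.map⁺ (prepend-injective false true) (afterLower-unique n k))
      (firstColumn-prepend true true)
      (firstColumn-prepend-≢ false true (λ ())))
    (firstColumn-prepend false false)
    (Sum.[ firstColumn-prepend-≢ true true (λ ()) , firstColumn-prepend-≢ false true (λ ()) ]′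
      ∘ ∈-++⁻ (map (prepend true true) (afterFull n k)))

afterEmpty-unique n k false = closedSets-unique n k false
afterEmpty-unique n k true = []

afterFull-unique n (suc (suc k)) = closedSets-unique n k true
afterFull-unique n zero = []
afterFull-unique n (suc zero) = []

afterLower-unique n (suc k) = closedSets-unique n k false
afterLower-unique n zero = []

∈-closedSets : ∀ n k {A} → A ∈ closedSets n k false ⇔ ClosedOfSize n k A
∈-closedSets n k {A} = mk⇔ (proj₁ ∘ closedSets-sound n k false)
  λ { (closed , refl) → closedSets-complete n false A closed tt }

z≡length : ∀ n k → z n k ≡ length (closedSets n k false)
z≡length n k = count≡length _ (allVertexSets-enumerates n) (closedSets-unique n k false) (∈-closedSets n k)

closedSets-vanish : ∀ n k t → n + n ℕ.< k → length (closedSets n k t) ≡ 0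
closedSets-vanish n k t n+n<k =
  empty⇒length≡0 λ A∈ → ℕ.<⇒≱ n+n<k (size≤ (proj₁ (closedSets-sound n k t A∈)))
  where
  size≤ : ∀ {A} → ClosedOfSize n k A → k ≤ n + n
  size≤ {U , L} (_ , refl) = ℕ.+-mono-≤ (∣p∣≤n U) (∣p∣≤n L)

closedSets-length-free : ∀ n k → length (closedSets (suc n) k false) ≡
                         length (closedSets n k false) + length (closedSets (suc n) k true)
closedSets-length-free n k = length-map-++ (prepend false false) (closedSets n k false) _

closedSets-length-free-beyond : ∀ n k → n + n ℕ.< k →
                                length (closedSets (suc n) k false) ≡ length (closedSets (suc n) k true)
closedSets-length-free-beyond n k n+n<k =
  trans (closedSets-length-free n k)
        (cong (_+ length (closedSets (suc n) k true)) (closedSets-vanish n k false n+n<k))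

closedSets-length-anchored : ∀ n k → length (closedSets (suc n) (suc (suc k)) true) ≡
                             length (closedSets n k true) + length (closedSets n (suc k) false)
closedSets-length-anchored n k =
  trans (length-map-++ (prepend true true) (closedSets n k true) _)
        (cong (length (closedSets n k true) +_) (List.length-map (prepend false true) (closedSets n (suc k) false)))

closedSets-length-anchored-one : ∀ n → length (closedSets (suc n) 1 true) ≡ length (closedSets n 0 false)
closedSets-length-anchored-one n = List.length-map (prepend false true) (closedSets n 0 false)

Partner : ℕ → ℕ → Set
Partner p q = Point p q → Point p q

FixedPointFreeInvolution : ∀ {p q} → Partner p q → Set
FixedPointFreeInvolution f = ∀ x → f x ≢ x × f (f x) ≡ x

TopPairsAdjacent : ∀ {p q} → Partner p q → Set
TopPairsAdjacent {p} f = ∀ (a b c : Fin p) → f (inj₁ a) ≡ inj₁ b → a < c → c < b → ⊥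

BottomPairsAdjacent : ∀ {p q} → Partner p q → Set
BottomPairsAdjacent {q = q} f = ∀ (a b c : Fin q) → f (inj₂ a) ≡ inj₂ b → a < c → c < b → ⊥

NonCrossing : ∀ {p q} → Partner p q → Set
NonCrossing {p} {q} f = ∀ (a a′ : Fin p) (b b′ : Fin q) →
  f (inj₁ a) ≡ inj₂ b → f (inj₁ a′) ≡ inj₂ b′ → a < a′ → b < b′

-- Matching (partner μ) unfolds to ValidPairing μ.
Matching : ∀ {p q} → Partner p q → Set
Matching f = FixedPointFreeInvolution f × TopPairsAdjacent f × BottomPairsAdjacent f × NonCrossing f

pair-sym : ∀ {p q} {f : Partner p q} → FixedPointFreeInvolution f → ∀ {x y} → f x ≡ y → f y ≡ x
pair-sym {f = f} involution {x} fx≡y = trans (cong f (sym fx≡y)) (proj₂ (involution x))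

Matching-resp-≗ : ∀ {p q} {f g : Partner p q} → f ≗ g → Matching f → Matching g
Matching-resp-≗ {f = f} {g} f≗g (involution , top , bottom , crossing) =
  (λ x → (proj₁ (involution x) ∘ trans (f≗g x)) ,
         trans (cong g (sym (f≗g x))) (trans (sym (f≗g (f x))) (proj₂ (involution x)))) ,
  (λ a b c → top a b c ∘ trans (f≗g _)) ,
  (λ a b c → bottom a b c ∘ trans (f≗g _)) ,
  (λ a a′ b b′ fa fa′ → crossing a a′ b b′ (trans (f≗g _) fa) (trans (f≗g _) fa′))

fromPartner : ∀ {p q} → Partner p q → Pairing p q
fromPartner {p} {q} f = tabulate (join p q ∘ f ∘ splitAt p)

partner-fromPartner : ∀ {p q} (f : Partner p q) → partner {p} {q} (fromPartner f) ≗ f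
partner-fromPartner {p} {q} f x = begin
  splitAt p (lookup (fromPartner f) (join p q x))    ≡⟨ cong (splitAt p) (Vec.lookup∘tabulate _ (join p q x)) ⟩
  splitAt p (join p q (f (splitAt p (join p q x))))  ≡⟨ Fin.splitAt-join p q _ ⟩
  f (splitAt p (join p q x))                         ≡⟨ cong f (Fin.splitAt-join p q x) ⟩
  f x                                                ∎
  where open ≡-Reasoning

fromPartner-partner : ∀ {p q} (μ : Pairing p q) → fromPartner (partner {p} {q} μ) ≡ μ
fromPartner-partner {p} {q} μ =
  trans (Vec.tabulate-cong λ i → trans (Fin.join-splitAt p q _) (cong (lookup μ) (Fin.join-splitAt p q i)))
        (Vec.tabulate∘lookup μ)

fromPartner-cong : ∀ {p q} {f g : Partner p q} → f ≗ g → fromPartner f ≡ fromPartner g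
fromPartner-cong {p} {q} f≗g = Vec.tabulate-cong (cong (join p q) ∘ f≗g ∘ splitAt p)

-- Inserting a leading pair

↑ʳ-mono-< : ∀ {m} d {a b : Fin m} → a < b → d ↑ʳ a < d ↑ʳ b
↑ʳ-mono-< zero a<b = a<b
↑ʳ-mono-< (suc d) a<b = s<s (↑ʳ-mono-< d a<b)

↑ʳ-cancel-< : ∀ {m} d {a b : Fin m} → d ↑ʳ a < d ↑ʳ b → a < b
↑ʳ-cancel-< zero a<b = a<b
↑ʳ-cancel-< (suc d) a<b = ↑ʳ-cancel-< d (s<s⁻¹ a<b)

shift : ∀ {p q} d₁ d₂ → Point p q → Point (d₁ + p) (d₂ + q)
shift d₁ d₂ = Sum.map (d₁ ↑ʳ_) (d₂ ↑ʳ_)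

shift-injective : ∀ {p q} d₁ d₂ {x y : Point p q} → shift d₁ d₂ x ≡ shift d₁ d₂ y → x ≡ y
shift-injective d₁ d₂ {inj₁ a} {inj₁ b} eq = cong inj₁ (Fin.↑ʳ-injective d₁ a b (Sum.inj₁-injective eq))
shift-injective d₁ d₂ {inj₂ a} {inj₂ b} eq = cong inj₂ (Fin.↑ʳ-injective d₂ a b (Sum.inj₂-injective eq))

data Decomposition {p q : ℕ} (d₁ d₂ : ℕ) (new₁ new₂ : Point (d₁ + p) (d₂ + q)) :
                   Point (d₁ + p) (d₂ + q) → Set where
  first  : Decomposition d₁ d₂ new₁ new₂ new₁
  second : Decomposition d₁ d₂ new₁ new₂ new₂
  old    : (y : Point p q) → Decomposition d₁ d₂ new₁ new₂ (shift d₁ d₂ y)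

record PairInsertion (p q d₁ d₂ : ℕ) : Set where
  field
    new₁ new₂       : Point (d₁ + p) (d₂ + q)
    decompose       : ∀ x → Decomposition {p} {q} d₁ d₂ new₁ new₂ x
    decompose-shift : ∀ y → decompose (shift d₁ d₂ y) ≡ old y
    new₁≢new₂       : new₁ ≢ new₂
    shift≢new₁      : ∀ y → shift d₁ d₂ y ≢ new₁
    shift≢new₂      : ∀ y → shift d₁ d₂ y ≢ new₂

module Insertion {p q d₁ d₂ : ℕ} (I : PairInsertion p q d₁ d₂) where

  open PairInsertion I

  private
    p′ q′ : ℕ
    p′ = d₁ + p
    q′ = d₂ + q
    embed : Point p q → Point p′ q′
    embed = shift d₁ d₂

  insertAt : Partner p q → ∀ {x} → Decomposition d₁ d₂ new₁ new₂ x → Point p′ q′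
  insertAt f first = new₂
  insertAt f second = new₁
  insertAt f (old y) = embed (f y)

  insert : Partner p q → Partner p′ q′
  insert f x = insertAt f (decompose x)

  insert-shift : ∀ f y → insert f (embed y) ≡ embed (f y)
  insert-shift f y = cong (insertAt f) (decompose-shift y)

  insert-new₁ : ∀ f → insert f new₁ ≡ new₂
  insert-new₁ f = at (decompose new₁) refl
    where
    at : ∀ {x} (d : Decomposition d₁ d₂ new₁ new₂ x) → x ≡ new₁ → insertAt f d ≡ new₂
    at first _ = refl
    at second new₂≡new₁ = ⊥-elim (new₁≢new₂ (sym new₂≡new₁))
    at (old y) y≡new₁ = ⊥-elim (shift≢new₁ y y≡new₁)

  insert-new₂ : ∀ f → insert f new₂ ≡ new₁
  insert-new₂ f = at (decompose new₂) refl
    where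
    at : ∀ {x} (d : Decomposition d₁ d₂ new₁ new₂ x) → x ≡ new₂ → insertAt f d ≡ new₁
    at first new₁≡new₂ = ⊥-elim (new₁≢new₂ new₁≡new₂)
    at second _ = refl
    at (old y) y≡new₂ = ⊥-elim (shift≢new₂ y y≡new₂)

  insert-cong : ∀ {f g} → f ≗ g → insert f ≗ insert g
  insert-cong {f} {g} f≗g x = at (decompose x)
    where
    at : ∀ {x} (d : Decomposition d₁ d₂ new₁ new₂ x) → insertAt f d ≡ insertAt g d
    at first = refl
    at second = refl
    at (old y) = cong embed (f≗g y)

  FixedPointFreeInvolution-insert : ∀ {f} → FixedPointFreeInvolution f → FixedPointFreeInvolution (insert f)
  FixedPointFreeInvolution-insert {f} involution x = at (decompose x)
    where
    at : ∀ {x} (d : Decomposition d₁ d₂ new₁ new₂ x) → insertAt f d ≢ x × insert f (insertAt f d) ≡ x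
    at first = new₁≢new₂ ∘ sym , insert-new₂ f
    at second = new₁≢new₂ , insert-new₁ f
    at (old y) = proj₁ (involution y) ∘ shift-injective d₁ d₂ ,
                 trans (insert-shift f (f y)) (cong embed (proj₂ (involution y)))

  -- Junk on the new points: remove is only applied where new₁ and new₂ are partners.
  removeAt : Point p q → ∀ {x} → Decomposition d₁ d₂ new₁ new₂ x → Point p q
  removeAt _ (old y) = y
  removeAt y first = y
  removeAt y second = y

  remove : Partner p′ q′ → Partner p q
  remove g y = removeAt y (decompose (g (embed y)))

  remove-cong : ∀ {f g} → f ≗ g → remove f ≗ remove g
  remove-cong f≗g y = cong (removeAt y ∘ decompose) (f≗g (embed y))

  remove-insert : ∀ f → remove (insert f) ≗ f
  remove-insert f y = trans (cong (removeAt y ∘ decompose) (insert-shift f y))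
                            (cong (removeAt y) (decompose-shift (f y)))

  Leading : Partner p′ q′ → Set
  Leading g = g new₁ ≡ new₂

  module _ {g : Partner p′ q′} (involution : FixedPointFreeInvolution g) (leading : Leading g) where

    shift-remove : ∀ y → g (embed y) ≡ embed (remove g y)
    shift-remove y = at (decompose (g (embed y))) refl
      where
      at : ∀ {x} (d : Decomposition d₁ d₂ new₁ new₂ x) → g (embed y) ≡ x → x ≡ embed (removeAt y d)
      at first g[y]≡new₁ = ⊥-elim (shift≢new₂ y (trans (sym (pair-sym involution g[y]≡new₁)) leading))
      at second g[y]≡new₂ =
        ⊥-elim (shift≢new₁ y (trans (sym (pair-sym involution g[y]≡new₂)) (pair-sym involution leading)))
      at (old _) _ = refl

    insert-remove : insert (remove g) ≗ g
    insert-remove x = at (decompose x)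
      where
      at : ∀ {x} (d : Decomposition d₁ d₂ new₁ new₂ x) → insertAt (remove g) d ≡ g x
      at first = sym leading
      at second = sym (pair-sym involution leading)
      at (old y) = sym (shift-remove y)

    Matching-remove : Matching g → Matching (remove g)
    Matching-remove (_ , top , bottom , crossing) = involution′ , top′ , bottom′ , crossing′
      where
      moved : ∀ {y z} → remove g y ≡ z → g (embed y) ≡ embed z
      moved {y} eq = trans (shift-remove y) (cong embed eq)
      involution′ : FixedPointFreeInvolution (remove g)
      involution′ y = proj₁ (involution (embed y)) ∘ moved ,
        shift-injective d₁ d₂ (trans (sym (shift-remove (remove g y)))
                                     (trans (cong g (sym (shift-remove y))) (proj₂ (involution (embed y)))))
      top′ : TopPairsAdjacent (remove g)
      top′ a b c eq a<c c<b = top _ _ (d₁ ↑ʳ c) (moved eq) (↑ʳ-mono-< d₁ a<c) (↑ʳ-mono-< d₁ c<b)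
      bottom′ : BottomPairsAdjacent (remove g)
      bottom′ a b c eq a<c c<b = bottom _ _ (d₂ ↑ʳ c) (moved eq) (↑ʳ-mono-< d₂ a<c) (↑ʳ-mono-< d₂ c<b)
      crossing′ : NonCrossing (remove g)
      crossing′ a a′ b b′ eq eq′ a<a′ =
        ↑ʳ-cancel-< d₂ (crossing _ _ _ _ (moved eq) (moved eq′) (↑ʳ-mono-< d₁ a<a′))

  extend : Pairing p q → Pairing p′ q′
  extend μ = fromPartner (insert (partner {p} {q} μ))

  shrink : Pairing p′ q′ → Pairing p q
  shrink ν = fromPartner (remove (partner {p′} {q′} ν))

  partner-extend : ∀ μ → partner {p′} {q′} (extend μ) ≗ insert (partner {p} {q} μ)
  partner-extend μ = partner-fromPartner _

  shrink-extend : ∀ μ → shrink (extend μ) ≡ μ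
  shrink-extend μ = trans (fromPartner-cong λ y → trans (remove-cong (partner-extend μ) y) (remove-insert _ y))
                          (fromPartner-partner {p} {q} μ)

  extend-injective : ∀ {μ μ′} → extend μ ≡ extend μ′ → μ ≡ μ′
  extend-injective {μ} {μ′} eq = trans (sym (shrink-extend μ)) (trans (cong shrink eq) (shrink-extend μ′))

  Leading-extend : ∀ μ → Leading (partner {p′} {q′} (extend μ))
  Leading-extend μ = trans (partner-extend μ new₁) (insert-new₁ _)

  Matching-extend : (∀ {f} → Matching f → Matching (insert f)) →
                    ∀ μ → Matching (partner {p} {q} μ) → Matching (partner {p′} {q′} (extend μ))
  Matching-extend Matching-insert μ matching =
    Matching-resp-≗ (sym ∘ partner-extend μ) (Matching-insert matching)

  partner-shrink : ∀ ν → partner {p} {q} (shrink ν) ≗ remove (partner {p′} {q′} ν)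
  partner-shrink ν = partner-fromPartner _

  module _ (ν : Pairing p′ q′) (matching : Matching (partner {p′} {q′} ν))
           (leading : Leading (partner {p′} {q′} ν)) where

    extend-shrink : extend (shrink ν) ≡ ν
    extend-shrink = trans
      (fromPartner-cong λ x →
        trans (insert-cong (partner-shrink ν) x) (insert-remove (proj₁ matching) leading x))
      (fromPartner-partner {p′} {q′} ν)

    Matching-shrink : Matching (partner {p} {q} (shrink ν))
    Matching-shrink =
      Matching-resp-≗ (sym ∘ partner-shrink ν) (Matching-remove (proj₁ matching) leading matching)

    ∈-map-extend : ∀ {μs} → shrink ν ∈ μs → ν ∈ map extend μs
    ∈-map-extend {μs} ν′∈ = subst (_∈ map extend μs) extend-shrink (∈-map⁺ extend ν′∈)

  Leading-∈-map-extend : ∀ {ν μs} → ν ∈ map extend μs → Leading (partner {p′} {q′} ν)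
  Leading-∈-map-extend ν∈ with μ , _ , refl ← ∈-map⁻ extend ν∈ = Leading-extend μ

topPair : ∀ {p q} → PairInsertion p q 2 0
topPair = record
  { new₁ = inj₁ zero
  ; new₂ = inj₁ (suc zero)
  ; decompose = λ { (inj₁ zero) → first ; (inj₁ (suc zero)) → second
                  ; (inj₁ (suc (suc a))) → old (inj₁ a) ; (inj₂ b) → old (inj₂ b) }
  ; decompose-shift = λ { (inj₁ _) → refl ; (inj₂ _) → refl }
  ; new₁≢new₂ = λ ()
  ; shift≢new₁ = λ { (inj₁ _) () ; (inj₂ _) () }
  ; shift≢new₂ = λ { (inj₁ _) () ; (inj₂ _) () }
  }

bottomPair : ∀ {p q} → PairInsertion p q 0 2
bottomPair = record
  { new₁ = inj₂ zero
  ; new₂ = inj₂ (suc zero)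
  ; decompose = λ { (inj₂ zero) → first ; (inj₂ (suc zero)) → second
                  ; (inj₂ (suc (suc b))) → old (inj₂ b) ; (inj₁ a) → old (inj₁ a) }
  ; decompose-shift = λ { (inj₁ _) → refl ; (inj₂ _) → refl }
  ; new₁≢new₂ = λ ()
  ; shift≢new₁ = λ { (inj₁ _) () ; (inj₂ _) () }
  ; shift≢new₂ = λ { (inj₁ _) () ; (inj₂ _) () }
  }

crossPair : ∀ {p q} → PairInsertion p q 1 1
crossPair = record
  { new₁ = inj₁ zero
  ; new₂ = inj₂ zero
  ; decompose = λ { (inj₁ zero) → first ; (inj₂ zero) → second
                  ; (inj₁ (suc a)) → old (inj₁ a) ; (inj₂ (suc b)) → old (inj₂ b) }
  ; decompose-shift = λ { (inj₁ _) → refl ; (inj₂ _) → refl }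
  ; new₁≢new₂ = λ ()
  ; shift≢new₁ = λ { (inj₁ _) () ; (inj₂ _) () }
  ; shift≢new₂ = λ { (inj₁ _) () ; (inj₂ _) () }
  }

module TopPair {p q : ℕ} = Insertion (topPair {p} {q})
module BottomPair {p q : ℕ} = Insertion (bottomPair {p} {q})
module CrossPair {p q : ℕ} = Insertion (crossPair {p} {q})

Matching-insertTop : ∀ {p q} {f : Partner p q} → Matching f → Matching (TopPair.insert f)
Matching-insertTop {f = f} (involution , top , bottom , crossing) =
  TopPair.FixedPointFreeInvolution-insert involution , top′ , bottom′ , crossing′
  where
  top′ : TopPairsAdjacent (TopPair.insert f)
  top′ zero _ zero refl () _
  top′ zero _ (suc _) refl _ (s≤s ())
  top′ (suc zero) _ _ refl _ ()
  top′ (suc (suc a)) b c eq a<c c<b with f (inj₁ a) in fa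
  top′ (suc (suc a)) _ zero refl () _ | inj₁ _
  top′ (suc (suc a)) _ (suc zero) refl (s≤s ()) _ | inj₁ _
  top′ (suc (suc a)) _ (suc (suc c)) refl a<c c<b | inj₁ b =
    top a b c fa (s<s⁻¹ (s<s⁻¹ a<c)) (s<s⁻¹ (s<s⁻¹ c<b))
  top′ (suc (suc a)) _ _ () _ _ | inj₂ _
  bottom′ : BottomPairsAdjacent (TopPair.insert f)
  bottom′ a b c eq with f (inj₂ a) in fa
  bottom′ a _ c refl | inj₂ b = bottom a b c fa
  bottom′ a _ c () | inj₁ _
  crossing′ : NonCrossing (TopPair.insert f)
  crossing′ zero _ _ _ () _ _
  crossing′ (suc zero) _ _ _ () _ _
  crossing′ (suc (suc _)) zero _ _ _ () _
  crossing′ (suc (suc _)) (suc zero) _ _ _ () _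
  crossing′ (suc (suc a)) (suc (suc a′)) b b′ eq eq′ a<a′ with f (inj₁ a) in fa | f (inj₁ a′) in fa′
  crossing′ (suc (suc a)) (suc (suc a′)) _ _ refl refl a<a′ | inj₂ b | inj₂ b′ =
    crossing a a′ b b′ fa fa′ (s<s⁻¹ (s<s⁻¹ a<a′))
  crossing′ (suc (suc a)) (suc (suc a′)) _ _ () _ _ | inj₁ _ | _
  crossing′ (suc (suc a)) (suc (suc a′)) _ _ _ () _ | inj₂ _ | inj₁ _

Matching-insertBottom : ∀ {p q} {f : Partner p q} → Matching f → Matching (BottomPair.insert f)
Matching-insertBottom {f = f} (involution , top , bottom , crossing) =
  BottomPair.FixedPointFreeInvolution-insert involution , top′ , bottom′ , crossing′
  where
  top′ : TopPairsAdjacent (BottomPair.insert f)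
  top′ a b c eq with f (inj₁ a) in fa
  top′ a _ c refl | inj₁ b = top a b c fa
  top′ a _ c () | inj₂ _
  bottom′ : BottomPairsAdjacent (BottomPair.insert f)
  bottom′ zero _ zero refl () _
  bottom′ zero _ (suc _) refl _ (s≤s ())
  bottom′ (suc zero) _ _ refl _ ()
  bottom′ (suc (suc a)) b c eq a<c c<b with f (inj₂ a) in fa
  bottom′ (suc (suc a)) _ zero refl () _ | inj₂ _
  bottom′ (suc (suc a)) _ (suc zero) refl (s≤s ()) _ | inj₂ _
  bottom′ (suc (suc a)) _ (suc (suc c)) refl a<c c<b | inj₂ b =
    bottom a b c fa (s<s⁻¹ (s<s⁻¹ a<c)) (s<s⁻¹ (s<s⁻¹ c<b))
  bottom′ (suc (suc a)) _ _ () _ _ | inj₁ _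
  crossing′ : NonCrossing (BottomPair.insert f)
  crossing′ a a′ b b′ eq eq′ a<a′ with f (inj₁ a) in fa | f (inj₁ a′) in fa′
  crossing′ a a′ _ _ refl refl a<a′ | inj₂ b | inj₂ b′ = s<s (s<s (crossing a a′ b b′ fa fa′ a<a′))
  crossing′ a a′ _ _ () _ _ | inj₁ _ | _
  crossing′ a a′ _ _ _ () _ | inj₂ _ | inj₁ _

Matching-insertCross : ∀ {p q} {f : Partner p q} → Matching f → Matching (CrossPair.insert f)
Matching-insertCross {f = f} (involution , top , bottom , crossing) =
  CrossPair.FixedPointFreeInvolution-insert involution , top′ , bottom′ , crossing′
  where
  top′ : TopPairsAdjacent (CrossPair.insert f)
  top′ zero _ _ () _ _
  top′ (suc a) b c eq a<c c<b with f (inj₁ a) in fa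
  top′ (suc a) _ zero refl () _ | inj₁ _
  top′ (suc a) _ (suc c) refl a<c c<b | inj₁ b = top a b c fa (s<s⁻¹ a<c) (s<s⁻¹ c<b)
  top′ (suc a) _ _ () _ _ | inj₂ _
  bottom′ : BottomPairsAdjacent (CrossPair.insert f)
  bottom′ zero _ _ () _ _
  bottom′ (suc a) b c eq a<c c<b with f (inj₂ a) in fa
  bottom′ (suc a) _ zero refl () _ | inj₂ _
  bottom′ (suc a) _ (suc c) refl a<c c<b | inj₂ b = bottom a b c fa (s<s⁻¹ a<c) (s<s⁻¹ c<b)
  bottom′ (suc a) _ _ () _ _ | inj₁ _
  crossing′ : NonCrossing (CrossPair.insert f)
  crossing′ _ zero _ _ _ _ ()
  crossing′ zero (suc a′) _ _ refl eq′ _ with f (inj₁ a′)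
  crossing′ zero (suc a′) _ _ refl refl _ | inj₂ _ = s≤s z≤n
  crossing′ zero (suc a′) _ _ refl () _ | inj₁ _
  crossing′ (suc a) (suc a′) b b′ eq eq′ a<a′ with f (inj₁ a) in fa | f (inj₁ a′) in fa′
  crossing′ (suc a) (suc a′) _ _ refl refl a<a′ | inj₂ b | inj₂ b′ = s<s (crossing a a′ b b′ fa fa′ (s<s⁻¹ a<a′))
  crossing′ (suc a) (suc a′) _ _ () _ _ | inj₁ _ | _
  crossing′ (suc a) (suc a′) _ _ _ () _ | inj₂ _ | inj₁ _

-- Non-crossing pairings, by their leading pair

LeadingTopPair : ∀ {p q} → Partner p q → Set
LeadingTopPair {zero} _ = ⊥
LeadingTopPair {suc zero} _ = ⊥
LeadingTopPair {suc (suc _)} f = f (inj₁ zero) ≡ inj₁ (suc zero)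

LeadingBottomPair : ∀ {p q} → Partner p q → Set
LeadingBottomPair {q = zero} _ = ⊥
LeadingBottomPair {q = suc zero} _ = ⊥
LeadingBottomPair {q = suc (suc _)} f = f (inj₂ zero) ≡ inj₂ (suc zero)

leadingTopPair? : ∀ {p q} (f : Partner p q) → Dec (LeadingTopPair f)
leadingTopPair? {zero} _ = no λ ()
leadingTopPair? {suc zero} _ = no λ ()
leadingTopPair? {suc (suc _)} f = Sum.≡-dec Fin._≟_ Fin._≟_ _ _

leadingBottomPair? : ∀ {p q} (f : Partner p q) → Dec (LeadingBottomPair f)
leadingBottomPair? {q = zero} _ = no λ ()
leadingBottomPair? {q = suc zero} _ = no λ ()
leadingBottomPair? {q = suc (suc _)} f = Sum.≡-dec Fin._≟_ Fin._≟_ _ _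

LeadingTopPair-resp-≗ : ∀ {p q} {f g : Partner p q} → f ≗ g → LeadingTopPair f → LeadingTopPair g
LeadingTopPair-resp-≗ {suc (suc _)} f≗g leading = trans (sym (f≗g _)) leading

LeadingBottomPair-resp-≗ : ∀ {p q} {f g : Partner p q} → f ≗ g → LeadingBottomPair f → LeadingBottomPair g
LeadingBottomPair-resp-≗ {q = suc (suc _)} f≗g leading = trans (sym (f≗g _)) leading

LeadingTopPair-insertBottom : ∀ {p q} {f : Partner p q} →
                              LeadingTopPair (BottomPair.insert f) → LeadingTopPair f
LeadingTopPair-insertBottom {suc (suc _)} {f = f} leading =
  shift-injective 0 2 (trans (sym (BottomPair.insert-shift f (inj₁ zero))) leading)

LeadingTopPair-removeBottom : ∀ {p q} {g : Partner p (2 + q)} (involution : FixedPointFreeInvolution g)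
  (leading : BottomPair.Leading g) → LeadingTopPair (BottomPair.remove g) → LeadingTopPair g
LeadingTopPair-removeBottom {suc (suc _)} involution leading leadingTop =
  trans (BottomPair.shift-remove involution leading (inj₁ zero)) (cong (shift 0 2) leadingTop)

¬LeadingTopPair-insertCross : ∀ {p q} {f : Partner p q} → ¬ LeadingTopPair (CrossPair.insert f)
¬LeadingTopPair-insertCross {zero} ()
¬LeadingTopPair-insertCross {suc _} ()

¬LeadingBottomPair-insertCross : ∀ {p q} {f : Partner p q} → ¬ LeadingBottomPair (CrossPair.insert f)
¬LeadingBottomPair-insertCross {q = zero} ()
¬LeadingBottomPair-insertCross {q = suc _} ()

leftmostTop-crosses : ∀ {p q} {g : Partner (suc p) q} → Matching g → ¬ LeadingTopPair g →
                      ∃ λ b → g (inj₁ zero) ≡ inj₂ b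
leftmostTop-crosses {zero} {g = g} (involution , _) _ with g (inj₁ zero) in g0
... | inj₂ b = b , refl
... | inj₁ zero = ⊥-elim (proj₁ (involution (inj₁ zero)) g0)
leftmostTop-crosses {suc _} {g = g} (involution , top , _) ¬leading with g (inj₁ zero) in g0
... | inj₂ b = b , refl
... | inj₁ zero = ⊥-elim (proj₁ (involution (inj₁ zero)) g0)
... | inj₁ (suc zero) = ⊥-elim (¬leading refl)
... | inj₁ (suc (suc c)) = ⊥-elim (top zero (suc (suc c)) (suc zero) g0 (s≤s z≤n) (s≤s (s≤s z≤n)))

leftmostBottom-crosses : ∀ {p q} {g : Partner p (suc q)} → Matching g → ¬ LeadingBottomPair g →
                         ∃ λ a → g (inj₂ zero) ≡ inj₁ a
leftmostBottom-crosses {q = zero} {g = g} (involution , _) _ with g (inj₂ zero) in g0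
... | inj₁ a = a , refl
... | inj₂ zero = ⊥-elim (proj₁ (involution (inj₂ zero)) g0)
leftmostBottom-crosses {q = suc _} {g = g} (involution , _ , bottom , _) ¬leading with g (inj₂ zero) in g0
... | inj₁ a = a , refl
... | inj₂ zero = ⊥-elim (proj₁ (involution (inj₂ zero)) g0)
... | inj₂ (suc zero) = ⊥-elim (¬leading refl)
... | inj₂ (suc (suc c)) = ⊥-elim (bottom zero (suc (suc c)) (suc zero) g0 (s≤s z≤n) (s≤s (s≤s z≤n)))

leading-cross : ∀ {p q} {g : Partner (suc p) (suc q)} → Matching g →
                ¬ LeadingTopPair g → ¬ LeadingBottomPair g → CrossPair.Leading g
leading-cross matching@(involution , _ , _ , crossing) ¬top ¬bottom
  with leftmostTop-crosses matching ¬top | leftmostBottom-crosses matching ¬bottom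
... | zero , g0 | _ = g0
... | suc _ , g0 | zero , g0′ with () ← trans (sym g0) (pair-sym involution g0′)
... | suc b , g0 | suc a , g0′
  with () ← crossing zero (suc a) (suc b) zero g0 (pair-sym involution g0′) (s≤s z≤n)

Matching-empty : (f : Partner 0 0) → Matching f
Matching-empty _ = (λ { (inj₁ ()) ; (inj₂ ()) }) , (λ ()) , (λ ()) , (λ ())

IsMatching NoLeadingTop NoLeadingBottom : ∀ p q → Pairing p q → Set
IsMatching p q μ = Matching (partner {p} {q} μ)
NoLeadingTop p q μ = ¬ LeadingTopPair (partner {p} {q} μ)
NoLeadingBottom p q μ = ¬ LeadingBottomPair (partner {p} {q} μ)

matchings matchingsWithoutLeadingTop matchingsWithoutLeadingTopOrBottom : (p q : ℕ) → List (Pairing p q)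

matchings zero q = matchingsWithoutLeadingTop zero q
matchings (suc zero) q = matchingsWithoutLeadingTop (suc zero) q
matchings (suc (suc p)) q =
  map (TopPair.extend {p} {q}) (matchings p q) ++ matchingsWithoutLeadingTop (suc (suc p)) q

matchingsWithoutLeadingTop p zero = matchingsWithoutLeadingTopOrBottom p zero
matchingsWithoutLeadingTop p (suc zero) = matchingsWithoutLeadingTopOrBottom p (suc zero)
matchingsWithoutLeadingTop p (suc (suc q)) =
  map (BottomPair.extend {p} {q}) (matchingsWithoutLeadingTop p q) ++
  matchingsWithoutLeadingTopOrBottom p (suc (suc q))

matchingsWithoutLeadingTopOrBottom zero zero = [ [] ]
matchingsWithoutLeadingTopOrBottom zero (suc _) = []
matchingsWithoutLeadingTopOrBottom (suc _) zero = []
matchingsWithoutLeadingTopOrBottom (suc p) (suc q) = map (CrossPair.extend {p} {q}) (matchings p q)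

matchings-sound : ∀ p q {μ} → μ ∈ matchings p q → IsMatching p q μ
matchingsWithoutLeadingTop-sound : ∀ p q {μ} → μ ∈ matchingsWithoutLeadingTop p q →
  IsMatching p q μ × NoLeadingTop p q μ
matchingsWithoutLeadingTopOrBottom-sound : ∀ p q {μ} → μ ∈ matchingsWithoutLeadingTopOrBottom p q →
  IsMatching p q μ × NoLeadingTop p q μ × NoLeadingBottom p q μ

matchings-sound zero q μ∈ = proj₁ (matchingsWithoutLeadingTop-sound zero q μ∈)
matchings-sound (suc zero) q μ∈ = proj₁ (matchingsWithoutLeadingTop-sound (suc zero) q μ∈)
matchings-sound (suc (suc p)) q μ∈ = Sum.[
    ∈-map-elim {P = IsMatching (suc (suc p)) q} (TopPair.extend {p} {q})
      (λ {ν} ν∈ → TopPair.Matching-extend Matching-insertTop ν (matchings-sound p q ν∈)) ,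
    (λ μ∈ → proj₁ (matchingsWithoutLeadingTop-sound (suc (suc p)) q μ∈)) ]′
  (∈-++⁻ (map (TopPair.extend {p} {q}) (matchings p q)) μ∈)

matchingsWithoutLeadingTop-sound p zero μ∈ =
  map₂ proj₁ (matchingsWithoutLeadingTopOrBottom-sound p zero μ∈)
matchingsWithoutLeadingTop-sound p (suc zero) μ∈ =
  map₂ proj₁ (matchingsWithoutLeadingTopOrBottom-sound p (suc zero) μ∈)
matchingsWithoutLeadingTop-sound p (suc (suc q)) μ∈ = Sum.[
    ∈-map-elim {P = λ μ → IsMatching p (suc (suc q)) μ × NoLeadingTop p (suc (suc q)) μ}
      (BottomPair.extend {p} {q}) (λ {ν} ν∈ →
        let matching , ¬leading = matchingsWithoutLeadingTop-sound p q ν∈ in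
        BottomPair.Matching-extend Matching-insertBottom ν matching ,
        ¬leading ∘ LeadingTopPair-insertBottom ∘ LeadingTopPair-resp-≗ (BottomPair.partner-extend ν)) ,
    (λ μ∈ → map₂ proj₁ (matchingsWithoutLeadingTopOrBottom-sound p (suc (suc q)) μ∈)) ]′
  (∈-++⁻ (map (BottomPair.extend {p} {q}) (matchingsWithoutLeadingTop p q)) μ∈)

matchingsWithoutLeadingTopOrBottom-sound zero zero (here refl) = Matching-empty _ , (λ ()) , (λ ())
matchingsWithoutLeadingTopOrBottom-sound (suc p) (suc q) =
  ∈-map-elim {P = λ μ → IsMatching (suc p) (suc q) μ × NoLeadingTop (suc p) (suc q) μ ×
                       NoLeadingBottom (suc p) (suc q) μ}
    (CrossPair.extend {p} {q}) λ {ν} ν∈ →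
      CrossPair.Matching-extend Matching-insertCross ν (matchings-sound p q ν∈) ,
      ¬LeadingTopPair-insertCross ∘ LeadingTopPair-resp-≗ (CrossPair.partner-extend ν) ,
      ¬LeadingBottomPair-insertCross ∘ LeadingBottomPair-resp-≗ (CrossPair.partner-extend ν)

matchings-complete : ∀ p q μ → IsMatching p q μ → μ ∈ matchings p q
matchingsWithoutLeadingTop-complete : ∀ p q μ → IsMatching p q μ → NoLeadingTop p q μ →
  μ ∈ matchingsWithoutLeadingTop p q
matchingsWithoutLeadingTopOrBottom-complete : ∀ p q μ → IsMatching p q μ → NoLeadingTop p q μ →
  NoLeadingBottom p q μ → μ ∈ matchingsWithoutLeadingTopOrBottom p q

matchings-complete zero q μ matching = matchingsWithoutLeadingTop-complete zero q μ matching λ ()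
matchings-complete (suc zero) q μ matching = matchingsWithoutLeadingTop-complete (suc zero) q μ matching λ ()
matchings-complete (suc (suc p)) q μ matching = Sum.[
    (λ leading → ∈-++⁺ˡ (TopPair.∈-map-extend μ matching leading
      (matchings-complete p q _ (TopPair.Matching-shrink μ matching leading)))) ,
    (λ ¬leading → ∈-++⁺ʳ (map (TopPair.extend {p} {q}) (matchings p q))
      (matchingsWithoutLeadingTop-complete (suc (suc p)) q μ matching ¬leading)) ]′
  (toSum (leadingTopPair? (partner {suc (suc p)} {q} μ)))

matchingsWithoutLeadingTop-complete p zero μ matching ¬top =
  matchingsWithoutLeadingTopOrBottom-complete p zero μ matching ¬top λ ()
matchingsWithoutLeadingTop-complete p (suc zero) μ matching ¬top =
  matchingsWithoutLeadingTopOrBottom-complete p (suc zero) μ matching ¬top λ ()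
matchingsWithoutLeadingTop-complete p (suc (suc q)) μ matching ¬top = Sum.[
    (λ leading → ∈-++⁺ˡ (BottomPair.∈-map-extend μ matching leading
      (matchingsWithoutLeadingTop-complete p q _ (BottomPair.Matching-shrink μ matching leading)
        (¬top ∘ LeadingTopPair-removeBottom (proj₁ matching) leading
              ∘ LeadingTopPair-resp-≗ (BottomPair.partner-shrink μ))))) ,
    (λ ¬leading → ∈-++⁺ʳ (map (BottomPair.extend {p} {q}) (matchingsWithoutLeadingTop p q))
      (matchingsWithoutLeadingTopOrBottom-complete p (suc (suc q)) μ matching ¬top ¬leading)) ]′
  (toSum (leadingBottomPair? (partner {p} {suc (suc q)} μ)))

matchingsWithoutLeadingTopOrBottom-complete zero zero [] _ _ _ = here refl
matchingsWithoutLeadingTopOrBottom-complete zero (suc q) μ matching _ ¬bottom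
  with () ← proj₁ (leftmostBottom-crosses matching ¬bottom)
matchingsWithoutLeadingTopOrBottom-complete (suc p) zero μ matching ¬top _
  with () ← proj₁ (leftmostTop-crosses matching ¬top)
matchingsWithoutLeadingTopOrBottom-complete (suc p) (suc q) μ matching ¬top ¬bottom =
  CrossPair.∈-map-extend μ matching leading
    (matchings-complete p q _ (CrossPair.Matching-shrink μ matching leading))
  where
  leading : CrossPair.Leading (partner {suc p} {suc q} μ)
  leading = leading-cross matching ¬top ¬bottom

matchings-unique : ∀ p q → Unique (matchings p q)
matchingsWithoutLeadingTop-unique : ∀ p q → Unique (matchingsWithoutLeadingTop p q)
matchingsWithoutLeadingTopOrBottom-unique : ∀ p q → Unique (matchingsWithoutLeadingTopOrBottom p q)

matchings-unique zero q = matchingsWithoutLeadingTop-unique zero q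
matchings-unique (suc zero) q = matchingsWithoutLeadingTop-unique (suc zero) q
matchings-unique (suc (suc p)) q =
  ++⁺-separated (LeadingTopPair ∘ partner {suc (suc p)} {q})
    (Unique.map⁺ (TopPair.extend-injective {p} {q}) (matchings-unique p q))
    (matchingsWithoutLeadingTop-unique (suc (suc p)) q)
    (TopPair.Leading-∈-map-extend {p} {q})
    (proj₂ ∘ matchingsWithoutLeadingTop-sound (suc (suc p)) q)

matchingsWithoutLeadingTop-unique p zero = matchingsWithoutLeadingTopOrBottom-unique p zero
matchingsWithoutLeadingTop-unique p (suc zero) = matchingsWithoutLeadingTopOrBottom-unique p (suc zero)
matchingsWithoutLeadingTop-unique p (suc (suc q)) =
  ++⁺-separated (LeadingBottomPair ∘ partner {p} {suc (suc q)})
    (Unique.map⁺ (BottomPair.extend-injective {p} {q}) (matchingsWithoutLeadingTop-unique p q))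
    (matchingsWithoutLeadingTopOrBottom-unique p (suc (suc q)))
    (BottomPair.Leading-∈-map-extend {p} {q})
    (proj₂ ∘ proj₂ ∘ matchingsWithoutLeadingTopOrBottom-sound p (suc (suc q)))

matchingsWithoutLeadingTopOrBottom-unique zero zero = [] ∷ []
matchingsWithoutLeadingTopOrBottom-unique zero (suc _) = []
matchingsWithoutLeadingTopOrBottom-unique (suc _) zero = []
matchingsWithoutLeadingTopOrBottom-unique (suc p) (suc q) =
  Unique.map⁺ (CrossPair.extend-injective {p} {q}) (matchings-unique p q)

a≡length : ∀ p q → a p q ≡ length (matchings p q)
a≡length p q = count≡length (validPairing? {p} {q}) (allPairings-enumerates p q) (matchings-unique p q)
  (mk⇔ (matchings-sound p q) (matchings-complete p q _))

matchings-length-top : ∀ p q → length (matchings (suc (suc p)) q) ≡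
                       length (matchings p q) + length (matchingsWithoutLeadingTop (suc (suc p)) q)
matchings-length-top p q = length-map-++ (TopPair.extend {p} {q}) (matchings p q) _

matchingsWithoutLeadingTop-length-bottom : ∀ p q → length (matchingsWithoutLeadingTop p (suc (suc q))) ≡
  length (matchingsWithoutLeadingTop p q) + length (matchingsWithoutLeadingTopOrBottom p (suc (suc q)))
matchingsWithoutLeadingTop-length-bottom p q =
  length-map-++ (BottomPair.extend {p} {q}) (matchingsWithoutLeadingTop p q) _

matchingsWithoutLeadingTopOrBottom-length-cross : ∀ p q →
  length (matchingsWithoutLeadingTopOrBottom (suc p) (suc q)) ≡ length (matchings p q)
matchingsWithoutLeadingTopOrBottom-length-cross p q = List.length-map (CrossPair.extend {p} {q}) (matchings p q)

-- Comparing the two recurrences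

suc-suc-injective : ∀ {m n} → suc (suc m) ≡ suc (suc n) → m ≡ n
suc-suc-injective = ℕ.suc-injective ∘ ℕ.suc-injective

+-suc-suc : ∀ m n → m + suc (suc n) ≡ suc (suc (m + n))
+-suc-suc m n = trans (ℕ.+-suc m (suc n)) (cong suc (ℕ.+-suc m n))

LengthsAgree : ℕ → Set
LengthsAgree n = ∀ p q → p + q ≡ n + n →
  length (matchings p q) ≡ length (closedSets n q false) ×
  length (matchingsWithoutLeadingTop p q) ≡ length (closedSets n q true)

module LengthsAgreeStep (n : ℕ) (agree : LengthsAgree n) where

  withoutLeadingTopOrBottom-agree : ∀ p q → p + suc (suc q) ≡ suc (suc (n + n)) →
    length (matchingsWithoutLeadingTopOrBottom p (suc (suc q))) ≡ length (closedSets n (suc q) false)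
  withoutLeadingTopOrBottom-agree zero q e =
    sym (closedSets-vanish n (suc q) false (ℕ.≤-reflexive (cong suc (sym (suc-suc-injective e)))))
  withoutLeadingTopOrBottom-agree (suc p) q e = trans (matchingsWithoutLeadingTopOrBottom-length-cross p (suc q))
    (proj₁ (agree p (suc q) (suc-suc-injective (trans (sym (cong suc (ℕ.+-suc p (suc q)))) e))))

  withoutLeadingTop-agree : ∀ p q → p + q ≡ suc (suc (n + n)) →
    length (matchingsWithoutLeadingTop p q) ≡ length (closedSets (suc n) q true)
  withoutLeadingTop-agree (suc _) zero _ = refl
  withoutLeadingTop-agree (suc p) (suc zero) e = begin
    length (matchingsWithoutLeadingTopOrBottom (suc p) 1)
      ≡⟨ matchingsWithoutLeadingTopOrBottom-length-cross p 0 ⟩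
    length (matchings p 0)
      ≡⟨ proj₁ (agree p 0 (suc-suc-injective (trans (sym (cong suc (ℕ.+-suc p 0))) e))) ⟩
    length (closedSets n 0 false)
      ≡⟨ sym (closedSets-length-anchored-one n) ⟩
    length (closedSets (suc n) 1 true) ∎
    where open ≡-Reasoning
  withoutLeadingTop-agree p (suc (suc q)) e = begin
    length (matchingsWithoutLeadingTop p (suc (suc q)))
      ≡⟨ matchingsWithoutLeadingTop-length-bottom p q ⟩
    length (matchingsWithoutLeadingTop p q) + length (matchingsWithoutLeadingTopOrBottom p (suc (suc q)))
      ≡⟨ cong₂ _+_ (proj₂ (agree p q (suc-suc-injective (trans (sym (+-suc-suc p q)) e))))
                   (withoutLeadingTopOrBottom-agree p q e) ⟩
    length (closedSets n q true) + length (closedSets n (suc q) false)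
      ≡⟨ sym (closedSets-length-anchored n q) ⟩
    length (closedSets (suc n) (suc (suc q)) true) ∎
    where open ≡-Reasoning

  matchings-agree : ∀ p q → p + q ≡ suc (suc (n + n)) →
    length (matchings p q) ≡ length (closedSets (suc n) q false)
  matchings-agree zero q e = trans (withoutLeadingTop-agree zero q e)
    (sym (closedSets-length-free-beyond n q (subst (n + n ℕ.<_) (sym e) (ℕ.m<n⇒m<1+n (ℕ.n<1+n _)))))
  matchings-agree (suc zero) q e = trans (withoutLeadingTop-agree 1 q e)
    (sym (closedSets-length-free-beyond n q (ℕ.≤-reflexive (sym (ℕ.suc-injective e)))))
  matchings-agree (suc (suc p)) q e = begin
    length (matchings (suc (suc p)) q)
      ≡⟨ matchings-length-top p q ⟩
    length (matchings p q) + length (matchingsWithoutLeadingTop (suc (suc p)) q)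
      ≡⟨ cong₂ _+_ (proj₁ (agree p q (suc-suc-injective e))) (withoutLeadingTop-agree (suc (suc p)) q e) ⟩
    length (closedSets n q false) + length (closedSets (suc n) q true)
      ≡⟨ sym (closedSets-length-free n q) ⟩
    length (closedSets (suc n) q false) ∎
    where open ≡-Reasoning

lengthsAgree : ∀ n → LengthsAgree n
lengthsAgree zero zero zero _ = refl , refl
lengthsAgree (suc n) p q e = matchings-agree p q e′ , withoutLeadingTop-agree p q e′
  where
  open LengthsAgreeStep n (lengthsAgree n)
  e′ : p + q ≡ suc (suc (n + n))
  e′ = trans e (cong suc (ℕ.+-suc n n))

theorem3 : (n k : ℕ) → 1 ≤ n → k ≤ 2 * n → z n k ≡ a (2 * n ∸ k) k
theorem3 n k _ k≤2n = begin
  z n k                             ≡⟨ z≡length n k ⟩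
  length (closedSets n k false)     ≡⟨ sym (proj₁ (lengthsAgree n (2 * n ∸ k) k balanced)) ⟩
  length (matchings (2 * n ∸ k) k)  ≡⟨ sym (a≡length (2 * n ∸ k) k) ⟩
  a (2 * n ∸ k) k                   ∎
  where
  open ≡-Reasoning
  balanced : 2 * n ∸ k + k ≡ n + n
  balanced = trans (ℕ.m∸n+n≡m k≤2n) (cong (n +_) (ℕ.+-identityʳ n))
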